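{- Let $d \ge 1$, let $A' \subseteq \mathbb{Z}^d$ be a finite nonempty set, and let $\phi: \mathbb{Z}^d \to \mathbb{Z}/2\mathbb{Z}$ be a surjective homomorphism. For $i \in \{0,1\}$ let $A'_i = A' \cap \phi^{ -1}(\{i\})$ and $\alpha_i = (|A'_i|/|A'|)^{1/2}$ (so $\alpha_0^2 + \alpha_1^2 = 1$). Suppose $\min\{\alpha_0, \alpha_1\} \le 0.1$. Then for some $i \in \{0,1\}$ (with $A'_i$ nonempty) we have \[ \frac{\mathcal{E}(A'_i)}{\mathcal{E}(A')} \ge (|A'|/|A'_i|)^{1/8}. \]
   Context: Counting measure is used on $\mathbb{Z}^d$. For a finite nonempty $X \subseteq \mathbb{Z}^d$, $\|1_X\|_{U^3}^8 = \sum_{x,h_1,h_2,h_3 \in \mathbb{Z}^d} \prod_{\omega \in \{0,1\}^3} 1_X(x + \omega_1 h_1 + \omega_2 h_2 + \omega_3 h_3)$ and $\mathcal{E}(X) = \|1_X\|_{U^3}/|X|^{1/2}$. -}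

module Defs where

open import Data.Nat as ℕ using (ℕ; zero; suc)
open import Data.Integer as ℤ using (ℤ)
open import Data.Fin using (Fin; zero; suc)
open import Data.Bool using (Bool; true; false; if_then_else_)
open import Data.Vec using (Vec; zipWith)
import Data.Vec.Properties as VecP
open import Data.List using (List; []; _∷_; map; length; filter)
open import Data.Nat.ListAction using (sum; product)
open import Data.List.Relation.Unary.Any using (any?)
open import Data.Product using (_×_; _,_)
open import Relation.Nullary.Decidable using (isYes)
open import Relation.Binary.PropositionalEquality using (_≡_)

ℤ^ : ℕ → Set
ℤ^ d = Vec ℤ d

_+ᵛ_ : ∀ {d} → ℤ^ d → ℤ^ d → ℤ^ d
_+ᵛ_ = zipWith ℤ._+_

_-ᵛ_ : ∀ {d} → ℤ^ d → ℤ^ d → ℤ^ d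
_-ᵛ_ = zipWith ℤ._-_

_≟ᵛ_ : ∀ {d} (x y : ℤ^ d) → Relation.Nullary.Decidable.Dec (x ≡ y)
_≟ᵛ_ = VecP.≡-dec ℤ._≟_

ℤ/2 : Set
ℤ/2 = Fin 2

_+₂_ : ℤ/2 → ℤ/2 → ℤ/2
zero +₂ y = y
suc zero +₂ zero = suc zero
suc zero +₂ suc zero = zero

-- indicator function 1_X : ℤ^d → ℕ of a finite set X (given as a duplicate-free list)
𝟙 : ∀ {d} → List (ℤ^ d) → ℤ^ d → ℕ
𝟙 X v = if isYes (any? (v ≟ᵛ_) X) then 1 else 0

cubeVertices : List (Bool × Bool × Bool)
cubeVertices =
  (false , false , false) ∷ (false , false , true) ∷ (false , true , false) ∷ (false , true , true) ∷
  (true , false , false) ∷ (true , false , true) ∷ (true , true , false) ∷ (true , true , true) ∷ []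

scale : ∀ {d} → Bool → ℤ^ d → ℤ^ d → ℤ^ d
scale true h v = v +ᵛ h
scale false h v = v

vertex : ∀ {d} → ℤ^ d → ℤ^ d → ℤ^ d → ℤ^ d → Bool × Bool × Bool → ℤ^ d
vertex x h₁ h₂ h₃ (ω₁ , ω₂ , ω₃) = scale ω₃ h₃ (scale ω₂ h₂ (scale ω₁ h₁ x))

cubeProd : ∀ {d} → List (ℤ^ d) → ℤ^ d → ℤ^ d → ℤ^ d → ℤ^ d → ℕ
cubeProd X x h₁ h₂ h₃ = product (map (λ ω → 𝟙 X (vertex x h₁ h₂ h₃ ω)) cubeVertices)

shifts : ∀ {d} → List (ℤ^ d) → ℤ^ d → List (ℤ^ d)
shifts X x = map (λ y → y -ᵛ x) X

-- ‖1_X‖_{U³}^8 = Σ_{x,h₁,h₂,h₃ ∈ ℤ^d} Π_ω 1_X(x + ω·h).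
-- The summand vanishes unless x ∈ X and x + h_k ∈ X for each k, so the
-- (finitely supported) sum is computed over x ∈ X, h_k ∈ X - x.
U3⁸ : ∀ {d} → List (ℤ^ d) → ℕ
U3⁸ X = sum (map (λ x →
          sum (map (λ h₁ →
            sum (map (λ h₂ →
              sum (map (λ h₃ → cubeProd X x h₁ h₂ h₃) (shifts X x)))
              (shifts X x)))
            (shifts X x)))
          X)

fibre : ∀ {d} → (ℤ^ d → ℤ/2) → List (ℤ^ d) → ℤ/2 → List (ℤ^ d)
fibre φ A i = filter (λ x → Data.Fin._≟_ (φ x) i) A

-- Write 1_A = 1_{A₀} + 1_{A₁} for the two fibres of φ and expand ‖1_A‖⁸ over the eight
-- vertices x + ω·h of the cube.  Since φ is a homomorphism, the colour φ(x + ω·h) is an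
-- affine function of ω, so only the sixteen affine colourings ω ↦ c₀ + ω·c contribute,
-- each as a Gowers inner product of fibre indicators.  The two constant colourings give
-- S = ‖1_{A₀}‖⁸ and T = ‖1_{A₁}‖⁸; by the Gowers–Cauchy–Schwarz inequality each of the
-- other fourteen terms is at most √(ST), so ‖1_A‖⁸ = S + T + M with M² ≤ 196 ST.  If the
-- claim failed for both fibres, expanding n³ = (a + b)³ (n = |A|, a = |A₀|, b = |A₁|)
-- would give 9n² < 196ab, which is impossible when one fibre has at most n/100 points.

module Submission where

open import Defs
open import Level using (Level)
open import Function using (_∘_)
open import Data.Bool using (Bool; true; false; if_then_else_)
open import Data.Product using (∃; _×_; _,_; proj₁; proj₂)
open import Data.Sum using (_⊎_; inj₁; inj₂; [_,_]′)
import Data.Sum as Sum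
open import Relation.Nullary using (yes; no; contradiction)
open import Relation.Nullary.Decidable using (Dec; isYes)
open import Relation.Binary.PropositionalEquality

open import Data.Nat using (ℕ; zero; suc; _+_; _*_; _^_; _≤_; _<_; z≤n; s≤s; _≟_)
open import Data.Nat.Properties
open import Data.Nat.ListAction using (sum; product)
open import Data.Nat.Tactic.RingSolver using (solve-∀)
open import Algebra.Properties.CommutativeSemigroup +-commutativeSemigroup
  using () renaming (interchange to +-interchange)
open import Algebra.Properties.CommutativeSemigroup *-commutativeSemigroup using (x∙yz≈y∙xz)
open import Data.Integer using (ℤ)
import Data.Integer as ℤ using (_+_; _-_)
import Data.Integer.Properties as ℤₚ
open import Data.Integer.Tactic.RingSolver using () renaming (solve-∀ to ℤ-solve-∀)
open import Data.Fin using (zero; suc) renaming (_≟_ to _≟₂_)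
open import Data.Vec using ([]; _∷_)
import Data.Vec.Properties as Vec

open import Data.List using (List; []; _∷_; map; length; concatMap; _++_; deduplicate)
open import Data.List.Properties using (map-cong)
open import Data.List.Membership.Propositional using (_∈_; _∉_)
open import Data.List.Membership.Propositional.Properties using (∈-map⁺; ∈-concatMap⁺; ∈-filter⁺; ∈-filter⁻)
open import Data.List.Relation.Unary.Any using (here; there; any?)
import Data.List.Relation.Unary.Any as Any
import Data.List.Relation.Unary.Any.Properties as Anyₚ
open import Data.List.Relation.Unary.All using (All; []; _∷_)
import Data.List.Relation.Unary.All as All
import Data.List.Relation.Unary.All.Properties as Allₚ
open import Data.List.Relation.Unary.AllPairs using ([]; _∷_)
open import Data.List.Relation.Unary.Unique.Propositional using (Unique)
import Data.List.Relation.Unary.Unique.Propositional.Properties as Uniqueₚ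
import Data.List.Relation.Unary.Unique.DecPropositional.Properties as Uniqueᵈ

private
  variable
    ℓ ℓ′ : Level
    V : Set ℓ
    W : Set ℓ′

∑ : List V → (V → ℕ) → ℕ
∑ L f = sum (map f L)

infix 5 ∑
syntax ∑ L (λ x → e) = ∑[ x ∈ L ] e

module _ {V : Set ℓ} where

  ∑-cong : ∀ L {f g : V → ℕ} → (∀ x → f x ≡ g x) → ∑ L f ≡ ∑ L g
  ∑-cong []      e = refl
  ∑-cong (x ∷ L) e = cong₂ _+_ (e x) (∑-cong L e)

  ∑-cong-∈ : ∀ L {f g : V → ℕ} → (∀ {x} → x ∈ L → f x ≡ g x) → ∑ L f ≡ ∑ L g
  ∑-cong-∈ []      e = refl
  ∑-cong-∈ (x ∷ L) e = cong₂ _+_ (e (here refl)) (∑-cong-∈ L (e ∘ there))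

  ∑-mono-≤ : ∀ L {f g : V → ℕ} → (∀ x → f x ≤ g x) → ∑ L f ≤ ∑ L g
  ∑-mono-≤ []      e = ≤-refl
  ∑-mono-≤ (x ∷ L) e = +-mono-≤ (e x) (∑-mono-≤ L e)

  ∑-mono-≤-∈ : ∀ L {f g : V → ℕ} → (∀ {x} → x ∈ L → f x ≤ g x) → ∑ L f ≤ ∑ L g
  ∑-mono-≤-∈ []      e = ≤-refl
  ∑-mono-≤-∈ (x ∷ L) e = +-mono-≤ (e (here refl)) (∑-mono-≤-∈ L (e ∘ there))

  ∑-zero : ∀ (L : List V) → ∑[ _ ∈ L ] 0 ≡ 0
  ∑-zero []      = refl
  ∑-zero (_ ∷ L) = ∑-zero L

  ∑-const : ∀ (L : List V) c → ∑[ _ ∈ L ] c ≡ length L * c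
  ∑-const []      c = refl
  ∑-const (_ ∷ L) c = cong (c +_) (∑-const L c)

  ∑-distrib-+ : ∀ L (f g : V → ℕ) → ∑[ x ∈ L ] (f x + g x) ≡ ∑ L f + ∑ L g
  ∑-distrib-+ []      f g = refl
  ∑-distrib-+ (x ∷ L) f g rewrite ∑-distrib-+ L f g = +-interchange (f x) (g x) (∑ L f) (∑ L g)

  ∑-*ˡ : ∀ L c (f : V → ℕ) → ∑[ x ∈ L ] (c * f x) ≡ c * ∑ L f
  ∑-*ˡ []      c f = sym (*-zeroʳ c)
  ∑-*ˡ (x ∷ L) c f rewrite ∑-*ˡ L c f = sym (*-distribˡ-+ c (f x) (∑ L f))

  ∑-*ʳ : ∀ L c (f : V → ℕ) → ∑[ x ∈ L ] (f x * c) ≡ ∑ L f * c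
  ∑-*ʳ L c f = trans (∑-cong L (λ x → *-comm (f x) c)) (trans (∑-*ˡ L c f) (*-comm c _))

  ∑-absorb : ∀ L c (f : V → ℕ) → (∀ x → c * f x ≡ f x) → c * ∑ L f ≡ ∑ L f
  ∑-absorb L c f e = trans (sym (∑-*ˡ L c f)) (∑-cong L e)

  ∑-++ : ∀ L M (f : V → ℕ) → ∑ (L ++ M) f ≡ ∑ L f + ∑ M f
  ∑-++ []      M f = refl
  ∑-++ (x ∷ L) M f rewrite ∑-++ L M f = sym (+-assoc (f x) (∑ L f) (∑ M f))

∑-map : ∀ (L : List V) (s : V → W) (f : W → ℕ) → ∑ (map s L) f ≡ ∑[ x ∈ L ] f (s x)
∑-map []      s f = refl
∑-map (x ∷ L) s f = cong (f (s x) +_) (∑-map L s f)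

module _ {V : Set ℓ} {W : Set ℓ′} where

  ∑-comm : ∀ L M (g : V → W → ℕ) → ∑[ x ∈ L ] ∑[ y ∈ M ] g x y ≡ ∑[ y ∈ M ] ∑[ x ∈ L ] g x y
  ∑-comm []      M g = sym (∑-zero M)
  ∑-comm (x ∷ L) M g rewrite ∑-comm L M g = sym (∑-distrib-+ M (g x) (λ y → ∑[ x ∈ L ] g x y))

  pairs : List V → List W → List (V × W)
  pairs L M = concatMap (λ x → map (x ,_) M) L

  ∑-pairs : ∀ L M (g : V → W → ℕ) → ∑[ x ∈ L ] ∑[ y ∈ M ] g x y ≡ ∑[ p ∈ pairs L M ] g (proj₁ p) (proj₂ p)
  ∑-pairs []      M g = refl
  ∑-pairs (x ∷ L) M g = begin
    (∑[ y ∈ M ] g x y) + (∑[ x ∈ L ] ∑[ y ∈ M ] g x y)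
      ≡⟨ cong₂ _+_ (sym (∑-map M (x ,_) (uncurried g))) (∑-pairs L M g) ⟩
    ∑ (map (x ,_) M) (uncurried g) + ∑ (pairs L M) (uncurried g)
      ≡⟨ sym (∑-++ (map (x ,_) M) (pairs L M) (uncurried g)) ⟩
    ∑ (pairs (x ∷ L) M) (uncurried g) ∎
    where
    open ≡-Reasoning
    uncurried : (V → W → ℕ) → V × W → ℕ
    uncurried g p = g (proj₁ p) (proj₂ p)

  ∑-*-∑ : ∀ L M (f : V → ℕ) (g : W → ℕ) → ∑ L f * ∑ M g ≡ ∑[ x ∈ L ] ∑[ y ∈ M ] f x * g y
  ∑-*-∑ L M f g = trans (sym (∑-*ʳ L (∑ M g) f)) (∑-cong L (λ x → sym (∑-*ˡ M (f x) g)))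

-- Cauchy–Schwarz

infix 10 _²
_² : ℕ → ℕ
n ² = n * n

2mn≤m²+n² : ∀ m n → 2 * (m * n) ≤ m ² + n ²
2mn≤m²+n² m n = [ ordered , flipped ]′ (≤-total m n)
  where
  square-gap : ∀ m k → 2 * (m * (m + k)) + k * k ≡ m * m + (m + k) * (m + k)
  square-gap = solve-∀
  ordered : ∀ {m n} → m ≤ n → 2 * (m * n) ≤ m ² + n ²
  ordered {m} m≤n with m≤n⇒∃[o]m+o≡n m≤n
  ... | k , refl = subst (2 * (m * (m + k)) ≤_) (square-gap m k) (m≤m+n _ (k ²))
  flipped : n ≤ m → 2 * (m * n) ≤ m ² + n ²
  flipped n≤m = subst₂ _≤_ (cong (2 *_) (*-comm n m)) (+-comm (n ²) (m ²)) (ordered n≤m)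

module _ {V : Set ℓ} where

  cauchy-schwarz : ∀ L (f g : V → ℕ) →
                   (∑[ x ∈ L ] f x * g x) ² ≤ (∑[ x ∈ L ] f x ²) * (∑[ x ∈ L ] g x ²)
  cauchy-schwarz L f g = *-cancelˡ-≤ 2 (begin
    2 * (∑[ x ∈ L ] f x * g x) ²
      ≡⟨ cong (2 *_) (∑-*-∑ L L _ _) ⟩
    2 * (∑[ i ∈ L ] ∑[ j ∈ L ] (f i * g i) * (f j * g j))
      ≡⟨ cong (2 *_) (∑-cong L λ i → ∑-cong L λ j → regroup (f i) (g i) (f j) (g j)) ⟩
    2 * (∑[ i ∈ L ] ∑[ j ∈ L ] (f i * g j) * (f j * g i))
      ≡⟨ trans (sym (∑-*ˡ L 2 _)) (∑-cong L λ i → sym (∑-*ˡ L 2 _)) ⟩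
    ∑[ i ∈ L ] ∑[ j ∈ L ] 2 * ((f i * g j) * (f j * g i))
      ≤⟨ ∑-mono-≤ L (λ i → ∑-mono-≤ L λ j → 2mn≤m²+n² (f i * g j) (f j * g i)) ⟩
    ∑[ i ∈ L ] ∑[ j ∈ L ] ((f i * g j) ² + (f j * g i) ²)
      ≡⟨ trans (∑-cong L λ i → ∑-distrib-+ L _ _) (∑-distrib-+ L _ _) ⟩
    P + (∑[ i ∈ L ] ∑[ j ∈ L ] (f j * g i) ²)
      ≡⟨ cong (P +_) (trans (∑-comm L L _) (sym (+-identityʳ P))) ⟩
    P + (P + 0)
      ≡⟨ cong (λ Q → Q + (Q + 0)) (sym ∑²∑²≡P) ⟩
    2 * ((∑[ x ∈ L ] f x ²) * (∑[ x ∈ L ] g x ²)) ∎)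
    where
    open ≤-Reasoning
    P : ℕ
    P = ∑[ i ∈ L ] ∑[ j ∈ L ] (f i * g j) ²
    regroup : ∀ a b c d → (a * b) * (c * d) ≡ (a * d) * (c * b)
    regroup = solve-∀
    ∑²∑²≡P : (∑[ x ∈ L ] f x ²) * (∑[ x ∈ L ] g x ²) ≡ P
    ∑²∑²≡P = trans (∑-*-∑ L L _ _)
      (∑-cong L λ i → ∑-cong L λ j → [m*n]*[o*p]≡[m*o]*[n*p] (f i) (f i) (g j) (g j))

  ∑²≤length*∑² : ∀ L (f : V → ℕ) → (∑ L f) ² ≤ length L * (∑[ x ∈ L ] f x ²)
  ∑²≤length*∑² L f = subst₂ _≤_
    (cong _² (∑-cong L λ x → *-identityˡ (f x)))
    (cong (_* (∑[ x ∈ L ] f x ²)) (trans (∑-const L 1) (*-identityʳ (length L))))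
    (cauchy-schwarz L (λ _ → 1) f)

module _ {V : Set ℓ} {W : Set ℓ′} where

  cauchy-schwarz₂ : ∀ L M (f g : V → W → ℕ) →
    (∑[ x ∈ L ] ∑[ y ∈ M ] f x y * g x y) ² ≤
      (∑[ x ∈ L ] ∑[ y ∈ M ] f x y ²) * (∑[ x ∈ L ] ∑[ y ∈ M ] g x y ²)
  cauchy-schwarz₂ L M f g = subst₂ _≤_
    (cong _² (sym (∑-pairs L M _)))
    (sym (cong₂ _*_ (∑-pairs L M _) (∑-pairs L M _)))
    (cauchy-schwarz (pairs L M) (λ p → f (proj₁ p) (proj₂ p)) (λ p → g (proj₁ p) (proj₂ p)))

²-cancel-≤ : ∀ {m n} → m ² ≤ n ² → m ≤ n
²-cancel-≤ {m} {n} m²≤n² with m ≤? n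
... | yes m≤n = m≤n
... | no  m≰n = contradiction m²≤n² (<⇒≱ (*-mono-< (≰⇒> m≰n) (≰⇒> m≰n)))

²≤-via-geometric-mean : ∀ p q r {w} → p ² ≤ q * r → q ² ≤ w → r ² ≤ w → p ² ≤ w
²≤-via-geometric-mean p q r {w} p²≤qr q²≤w r²≤w = ²-cancel-≤ (begin
  p ² ²          ≤⟨ *-mono-≤ p²≤qr p²≤qr ⟩
  (q * r) ²      ≡⟨ [m*n]*[o*p]≡[m*o]*[n*p] q r q r ⟩
  q ² * r ²      ≤⟨ *-mono-≤ q²≤w r²≤w ⟩
  w ² ∎)
  where open ≤-Reasoning

module _ {d : ℕ} where

  +ᵛ-comm : ∀ (x y : ℤ^ d) → x +ᵛ y ≡ y +ᵛ x
  +ᵛ-comm = Vec.zipWith-comm ℤₚ.+-comm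

  +ᵛ-assoc : ∀ (x y z : ℤ^ d) → (x +ᵛ y) +ᵛ z ≡ x +ᵛ (y +ᵛ z)
  +ᵛ-assoc = Vec.zipWith-assoc ℤₚ.+-assoc

  x+h+k≡x+k+h : ∀ (x h k : ℤ^ d) → (x +ᵛ h) +ᵛ k ≡ (x +ᵛ k) +ᵛ h
  x+h+k≡x+k+h x h k = begin
    (x +ᵛ h) +ᵛ k  ≡⟨ +ᵛ-assoc x h k ⟩
    x +ᵛ (h +ᵛ k)  ≡⟨ cong (x +ᵛ_) (+ᵛ-comm h k) ⟩
    x +ᵛ (k +ᵛ h)  ≡⟨ +ᵛ-assoc x k h ⟨
    (x +ᵛ k) +ᵛ h  ∎
    where open ≡-Reasoning

x+h-x≡h : ∀ {d} (x h : ℤ^ d) → (x +ᵛ h) -ᵛ x ≡ h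
x+h-x≡h []      []      = refl
x+h-x≡h (a ∷ x) (b ∷ h) = cong₂ _∷_ (a+b-a≡b a b) (x+h-x≡h x h)
  where
  a+b-a≡b : ∀ (a b : ℤ) → (a ℤ.+ b) ℤ.- a ≡ b
  a+b-a≡b = ℤ-solve-∀

x+[y-x]≡y : ∀ {d} (x y : ℤ^ d) → x +ᵛ (y -ᵛ x) ≡ y
x+[y-x]≡y []      []      = refl
x+[y-x]≡y (a ∷ x) (b ∷ y) = cong₂ _∷_ (a+[b-a]≡b a b) (x+[y-x]≡y x y)
  where
  a+[b-a]≡b : ∀ (a b : ℤ) → a ℤ.+ (b ℤ.- a) ≡ b
  a+[b-a]≡b = ℤ-solve-∀

module _ {d : ℕ} where

  𝟙-∈ : ∀ {X : List (ℤ^ d)} {v} → v ∈ X → 𝟙 X v ≡ 1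
  𝟙-∈ {X} {v} v∈X with any? (v ≟ᵛ_) X
  ... | yes _   = refl
  ... | no  v∉X = contradiction v∈X v∉X

  𝟙-∉ : ∀ {X : List (ℤ^ d)} {v} → v ∉ X → 𝟙 X v ≡ 0
  𝟙-∉ {X} {v} v∉X with any? (v ≟ᵛ_) X
  ... | yes v∈X = contradiction v∈X v∉X
  ... | no  _   = refl

  𝟙-idem : ∀ (X : List (ℤ^ d)) v → 𝟙 X v * 𝟙 X v ≡ 𝟙 X v
  𝟙-idem X v with any? (v ≟ᵛ_) X
  ... | yes _ = refl
  ... | no  _ = refl

  δ : ℤ^ d → ℤ^ d → ℕ
  δ u v = if isYes (u ≟ᵛ v) then 1 else 0

  δ-≡ : ∀ {u v} → u ≡ v → δ u v ≡ 1
  δ-≡ {u} {v} u≡v with u ≟ᵛ v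
  ... | yes _   = refl
  ... | no  u≢v = contradiction u≡v u≢v

  δ-≢ : ∀ {u v} → u ≢ v → δ u v ≡ 0
  δ-≢ {u} {v} u≢v with u ≟ᵛ v
  ... | yes u≡v = contradiction u≡v u≢v
  ... | no  _   = refl

  𝟙-∷-≢ : ∀ {X : List (ℤ^ d)} {y v} → v ≢ y → 𝟙 (y ∷ X) v ≡ 𝟙 X v
  𝟙-∷-≢ {X} {y} {v} v≢y = by-tail (any? (v ≟ᵛ_) X)
    where
    by-tail : Dec (v ∈ X) → 𝟙 (y ∷ X) v ≡ 𝟙 X v
    by-tail (yes v∈X) = trans (𝟙-∈ (there v∈X)) (sym (𝟙-∈ v∈X))
    by-tail (no  v∉X) = trans (𝟙-∉ λ { (here v≡y) → v≢y v≡y ; (there v∈X) → v∉X v∈X }) (sym (𝟙-∉ v∉X))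

  ∑-δ : ∀ {X : List (ℤ^ d)} → Unique X → ∀ u → ∑ X (δ u) ≡ 𝟙 X u
  ∑-δ {[]}    []             u = refl
  ∑-δ {y ∷ X} (y∉X ∷ uniqX) u = trans (cong (δ u y +_) (∑-δ uniqX u)) (by-head (u ≟ᵛ y))
    where
    by-head : Dec (u ≡ y) → δ u y + 𝟙 X u ≡ 𝟙 (y ∷ X) u
    by-head (yes u≡y) = begin
      δ u y + 𝟙 X u  ≡⟨ cong₂ _+_ (δ-≡ u≡y) (𝟙-∉ (Allₚ.All¬⇒¬Any y∉X ∘ Any.map (trans (sym u≡y)))) ⟩
      1              ≡⟨ 𝟙-∈ (here u≡y) ⟨
      𝟙 (y ∷ X) u    ∎
      where open ≡-Reasoning
    by-head (no u≢y) = trans (cong (_+ 𝟙 X u) (δ-≢ u≢y)) (sym (𝟙-∷-≢ u≢y))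

  ∑-reindex : ∀ {X D : List (ℤ^ d)} → Unique X → Unique D →
              (σ τ : ℤ^ d → ℤ^ d) → (∀ y → τ (σ y) ≡ y) → (∀ h → σ (τ h) ≡ h) →
              (∀ {y} → y ∈ X → σ y ∈ D) →
              ∀ T → ∑ X T ≡ ∑[ h ∈ D ] 𝟙 X (τ h) * T (τ h)
  ∑-reindex {X} {D} uniqX uniqD σ τ τσ στ σ[X]⊆D T = begin
    ∑ X T
      ≡⟨ ∑-cong-∈ X (λ y∈X → counted y∈X) ⟨
    ∑[ y ∈ X ] ∑ D (δ (σ y)) * T y
      ≡⟨ ∑-cong X (λ y → ∑-*ʳ D (T y) (δ (σ y))) ⟨
    ∑[ y ∈ X ] ∑[ h ∈ D ] δ (σ y) h * T y
      ≡⟨ ∑-comm X D _ ⟩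
    ∑[ h ∈ D ] ∑[ y ∈ X ] δ (σ y) h * T y
      ≡⟨ ∑-cong D (λ h → ∑-cong X (λ y → transpose y h (σ y ≟ᵛ h))) ⟩
    ∑[ h ∈ D ] ∑[ y ∈ X ] δ (τ h) y * T (τ h)
      ≡⟨ ∑-cong D (λ h → trans (∑-*ʳ X _ _) (cong (_* T (τ h)) (∑-δ uniqX (τ h)))) ⟩
    ∑[ h ∈ D ] 𝟙 X (τ h) * T (τ h) ∎
    where
    open ≡-Reasoning
    counted : ∀ {y} → y ∈ X → ∑ D (δ (σ y)) * T y ≡ T y
    counted y∈X = trans (cong (_* T _) (trans (∑-δ uniqD _) (𝟙-∈ (σ[X]⊆D y∈X)))) (+-identityʳ _)
    transpose : ∀ y h → Dec (σ y ≡ h) → δ (σ y) h * T y ≡ δ (τ h) y * T (τ h)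
    transpose y h (yes σy≡h) = cong₂ _*_ (trans (δ-≡ σy≡h) (sym (δ-≡ τh≡y))) (cong T (sym τh≡y))
      where
      τh≡y : τ h ≡ y
      τh≡y = trans (cong τ (sym σy≡h)) (τσ y)
    transpose y h (no σy≢h) = trans (cong (_* T y) (δ-≢ σy≢h))
      (sym (cong (_* T (τ h)) (δ-≢ λ τh≡y → σy≢h (trans (cong σ (sym τh≡y)) (στ h)))))

  ∑-restrict : ∀ {X A : List (ℤ^ d)} → Unique X → Unique A → (∀ {y} → y ∈ X → y ∈ A) →
               ∀ T → ∑ X T ≡ ∑[ y ∈ A ] 𝟙 X y * T y
  ∑-restrict uniqX uniqA X⊆A = ∑-reindex uniqX uniqA (λ y → y) (λ y → y) (λ _ → refl) (λ _ → refl) X⊆A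

  ∑-shifts : ∀ {X D : List (ℤ^ d)} {x} → Unique X → Unique D → (∀ {y} → y ∈ X → y -ᵛ x ∈ D) →
             ∀ g → (∀ h → 𝟙 X (x +ᵛ h) * g h ≡ g h) → ∑ (shifts X x) g ≡ ∑ D g
  ∑-shifts {X} {D} {x} uniqX uniqD X-x⊆D g g⊆X-x = begin
    ∑ (shifts X x) g
      ≡⟨ ∑-map X (λ y → y -ᵛ x) g ⟩
    ∑[ y ∈ X ] g (y -ᵛ x)
      ≡⟨ ∑-reindex uniqX uniqD (λ y → y -ᵛ x) (x +ᵛ_) (x+[y-x]≡y x) (x+h-x≡h x) X-x⊆D _ ⟩
    ∑[ h ∈ D ] 𝟙 X (x +ᵛ h) * g ((x +ᵛ h) -ᵛ x)
      ≡⟨ ∑-cong D (λ h → trans (cong (λ h' → 𝟙 X (x +ᵛ h) * g h') (x+h-x≡h x h)) (g⊆X-x h)) ⟩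
    ∑ D g ∎
    where open ≡-Reasoning

-- The cube {0,1}³

0∈⇒product≡0 : ∀ {ns : List ℕ} → 0 ∈ ns → product ns ≡ 0
0∈⇒product≡0 {n ∷ ns} (here refl) = refl
0∈⇒product≡0 {n ∷ ns} (there 0∈ns) = trans (cong (n *_) (0∈⇒product≡0 0∈ns)) (*-zeroʳ n)

product-absorb : ∀ {n} {ns : List ℕ} → n ∈ ns → n * n ≡ n → n * product ns ≡ product ns
product-absorb {n} {m ∷ ns} (here refl) n²≡n = trans (sym (*-assoc n n _)) (cong (_* product ns) n²≡n)
product-absorb {n} {m ∷ ns} (there n∈ns) n²≡n = begin
  n * (m * product ns)  ≡⟨ *-assoc n m _ ⟨
  n * m * product ns    ≡⟨ cong (_* product ns) (*-comm n m) ⟩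
  m * n * product ns    ≡⟨ *-assoc m n _ ⟩
  m * (n * product ns)  ≡⟨ cong (m *_) (product-absorb n∈ns n²≡n) ⟩
  m * product ns        ∎
  where open ≡-Reasoning

Cube : Set
Cube = Bool × Bool × Bool

Square : Set
Square = Bool × Bool

∏cube : (Cube → ℕ) → ℕ
∏cube g = product (map g cubeVertices)

∏square : (Square → ℕ) → ℕ
∏square g = g (false , false) * (g (false , true) * (g (true , false) * (g (true , true) * 1)))

lowerFace upperFace : (Cube → V) → Square → V
lowerFace f ω = f (false , ω)
upperFace f ω = f (true , ω)

lowerCopy upperCopy : Cube → Cube
lowerCopy (_ , ω) = false , ω
upperCopy (_ , ω) = true , ω

∈-cubeVertices : ∀ ω → ω ∈ cubeVertices
∈-cubeVertices (false , false , false) = here refl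
∈-cubeVertices (false , false , true)  = there (here refl)
∈-cubeVertices (false , true  , false) = there (there (here refl))
∈-cubeVertices (false , true  , true)  = there (there (there (here refl)))
∈-cubeVertices (true  , false , false) = there (there (there (there (here refl))))
∈-cubeVertices (true  , false , true)  = there (there (there (there (there (here refl)))))
∈-cubeVertices (true  , true  , false) = there (there (there (there (there (there (here refl))))))
∈-cubeVertices (true  , true  , true)  = there (there (there (there (there (there (there (here refl)))))))

∏cube-zero : ∀ g ω → g ω ≡ 0 → ∏cube g ≡ 0
∏cube-zero g ω gω≡0 = 0∈⇒product≡0 (subst (_∈ map g cubeVertices) gω≡0 (∈-map⁺ g (∈-cubeVertices ω)))

∏cube-absorb : ∀ g ω → g ω * g ω ≡ g ω → g ω * ∏cube g ≡ ∏cube g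
∏cube-absorb g ω = product-absorb (∈-map⁺ g (∈-cubeVertices ω))

∏cube-split : ∀ g → ∏cube g ≡ ∏square (lowerFace g) * ∏square (upperFace g)
∏cube-split g = split (g (false , false , false)) (g (false , false , true)) (g (false , true , false))
  (g (false , true , true)) (g (true , false , false)) (g (true , false , true)) (g (true , true , false))
  (g (true , true , true))
  where
  split : ∀ a b c d e f g h → a * (b * (c * (d * (e * (f * (g * (h * 1))))))) ≡
                              (a * (b * (c * (d * 1)))) * (e * (f * (g * (h * 1))))
  split = solve-∀

swap₁₂ swap₂₃ : Cube → Cube
swap₁₂ (ω₁ , ω₂ , ω₃) = ω₂ , ω₁ , ω₃
swap₂₃ (ω₁ , ω₂ , ω₃) = ω₁ , ω₃ , ω₂

∏cube-swap₁₂ : ∀ g → ∏cube (g ∘ swap₁₂) ≡ ∏cube g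
∏cube-swap₁₂ g = permute (g (false , false , false)) (g (false , false , true)) (g (false , true , false))
  (g (false , true , true)) (g (true , false , false)) (g (true , false , true)) (g (true , true , false))
  (g (true , true , true))
  where
  permute : ∀ a b c d e f g h → a * (b * (e * (f * (c * (d * (g * (h * 1))))))) ≡
                                a * (b * (c * (d * (e * (f * (g * (h * 1)))))))
  permute = solve-∀

∏cube-swap₂₃ : ∀ g → ∏cube (g ∘ swap₂₃) ≡ ∏cube g
∏cube-swap₂₃ g = permute (g (false , false , false)) (g (false , false , true)) (g (false , true , false))
  (g (false , true , true)) (g (true , false , false)) (g (true , false , true)) (g (true , true , false))
  (g (true , true , true))
  where
  permute : ∀ a b c d e f g h → a * (c * (b * (d * (e * (g * (f * (h * 1))))))) ≡
                                a * (b * (c * (d * (e * (f * (g * (h * 1)))))))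
  permute = solve-∀

module _ {d : ℕ} where

  scale-comm : ∀ ω ω' (h k y : ℤ^ d) → scale ω h (scale ω' k y) ≡ scale ω' k (scale ω h y)
  scale-comm true  true  h k y = x+h+k≡x+k+h y k h
  scale-comm true  false h k y = refl
  scale-comm false true  h k y = refl
  scale-comm false false h k y = refl

  vertex-swap₁₂ : ∀ (x h₁ h₂ h₃ : ℤ^ d) ω → vertex x h₁ h₂ h₃ (swap₁₂ ω) ≡ vertex x h₂ h₁ h₃ ω
  vertex-swap₁₂ x h₁ h₂ h₃ (ω₁ , ω₂ , ω₃) = cong (scale ω₃ h₃) (scale-comm ω₁ ω₂ h₂ h₁ x)

  vertex-swap₂₃ : ∀ (x h₁ h₂ h₃ : ℤ^ d) ω → vertex x h₁ h₂ h₃ (swap₂₃ ω) ≡ vertex x h₁ h₃ h₂ ω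
  vertex-swap₂₃ x h₁ h₂ h₃ (ω₁ , ω₂ , ω₃) = scale-comm ω₂ ω₃ h₃ h₂ (scale ω₁ h₁ x)

  squareVertex : ℤ^ d → ℤ^ d → ℤ^ d → Square → ℤ^ d
  squareVertex y h₂ h₃ (ω₂ , ω₃) = scale ω₃ h₃ (scale ω₂ h₂ y)

∏cube-cong : ∀ {g g'} → (∀ ω → g ω ≡ g' ω) → ∏cube g ≡ ∏cube g'
∏cube-cong g≗g' = cong product (map-cong g≗g' cubeVertices)

-- Gowers inner products over A

-- For functions supported on A every nonzero summand of the sum over (ℤ^d)⁴ has x ∈ A and
-- x + h_k ∈ A, so the h_k range over a set D ⊇ A − A without loss.
module GowersInnerProduct {d} {A D : List (ℤ^ d)} (uniqA : Unique A) (uniqD : Unique D)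
                          (A-A⊆D : ∀ {x y} → x ∈ A → y ∈ A → y -ᵛ x ∈ D) where

  ⟪_⟫ : (Cube → ℤ^ d → ℕ) → ℕ
  ⟪ f ⟫ = ∑[ x ∈ A ] ∑[ h₁ ∈ D ] ∑[ h₂ ∈ D ] ∑[ h₃ ∈ D ] ∏cube (λ ω → f ω (vertex x h₁ h₂ h₃ ω))

  Supported : (ℤ^ d → ℕ) → Set
  Supported g = ∀ v → 𝟙 A v * g v ≡ g v

  ⟪⟫-cong : ∀ {f g} → (∀ ω v → f ω v ≡ g ω v) → ⟪ f ⟫ ≡ ⟪ g ⟫
  ⟪⟫-cong {f} {g} f≗g = ∑-cong A λ x → ∑-cong D λ h₁ → ∑-cong D λ h₂ → ∑-cong D λ h₃ →
    ∏cube-cong {λ ω → f ω (vertex x h₁ h₂ h₃ ω)} {λ ω → g ω (vertex x h₁ h₂ h₃ ω)} λ ω → f≗g ω _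

  ⟪⟫-swap₁₂ : ∀ f → ⟪ f ∘ swap₁₂ ⟫ ≡ ⟪ f ⟫
  ⟪⟫-swap₁₂ f = trans
    (∑-cong A λ x → ∑-cong D λ h₁ → ∑-cong D λ h₂ → ∑-cong D λ h₃ → trans
      (∏cube-cong λ ω → cong (f (swap₁₂ ω)) (sym (vertex-swap₁₂ x h₂ h₁ h₃ ω)))
      (∏cube-swap₁₂ λ ω → f ω (vertex x h₂ h₁ h₃ ω)))
    (∑-cong A λ x → ∑-comm D D _)

  ⟪⟫-swap₂₃ : ∀ f → ⟪ f ∘ swap₂₃ ⟫ ≡ ⟪ f ⟫
  ⟪⟫-swap₂₃ f = trans
    (∑-cong A λ x → ∑-cong D λ h₁ → ∑-cong D λ h₂ → ∑-cong D λ h₃ → trans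
      (∏cube-cong λ ω → cong (f (swap₂₃ ω)) (sym (vertex-swap₂₃ x h₁ h₃ h₂ ω)))
      (∏cube-swap₂₃ λ ω → f ω (vertex x h₁ h₃ h₂ ω)))
    (∑-cong A λ x → ∑-cong D λ h₁ → ∑-comm D D _)

  ∑-translate : ∀ {x} → x ∈ A → ∀ T → Supported T → ∑[ h ∈ D ] T (x +ᵛ h) ≡ ∑ A T
  ∑-translate {x} x∈A T supp = begin
    ∑[ h ∈ D ] T (x +ᵛ h)         ≡⟨ ∑-shifts uniqA uniqD (A-A⊆D x∈A) _ (supp ∘ (x +ᵛ_)) ⟨
    ∑ (shifts A x) (T ∘ (x +ᵛ_))  ≡⟨ ∑-map A (λ y → y -ᵛ x) _ ⟩
    ∑[ y ∈ A ] T (x +ᵛ (y -ᵛ x))  ≡⟨ ∑-cong A (cong T ∘ x+[y-x]≡y x) ⟩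
    ∑ A T                         ∎
    where open ≡-Reasoning

  face : (Square → ℤ^ d → ℕ) → ℤ^ d → ℤ^ d → ℕ
  face g h₂ h₃ = ∑[ y ∈ A ] ∏square (λ ω → g ω (squareVertex y h₂ h₃ ω))

  ∏square-supported : ∀ (g : Square → ℤ^ d → ℕ) h₂ h₃ → Supported (g (false , false)) →
                      Supported (λ y → ∏square (λ ω → g ω (squareVertex y h₂ h₃ ω)))
  ∏square-supported g h₂ h₃ supp y =
    trans (sym (*-assoc (𝟙 A y) (g (false , false) y) rest)) (cong (_* rest) (supp y))
    where
    at : Square → ℕ
    at ω = g ω (squareVertex y h₂ h₃ ω)
    rest : ℕ
    rest = at (false , true) * (at (true , false) * (at (true , true) * 1))

  -- Substituting y = x + h₁ separates the faces ω₁ = 0 and ω₁ = 1.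
  ⟪⟫≡∑face*face : ∀ f → Supported (f (true , false , false)) →
    ⟪ f ⟫ ≡ ∑[ h₂ ∈ D ] ∑[ h₃ ∈ D ] face (lowerFace f) h₂ h₃ * face (upperFace f) h₂ h₃
  ⟪⟫≡∑face*face f supp = begin
    ⟪ f ⟫
      ≡⟨ ∑-cong A (λ x → ∑-cong D λ h₁ → ∑-cong D λ h₂ → ∑-cong D λ h₃ →
           ∏cube-split (λ ω → f ω (vertex x h₁ h₂ h₃ ω))) ⟩
    ∑[ x ∈ A ] ∑[ h₁ ∈ D ] ∑[ h₂ ∈ D ] ∑[ h₃ ∈ D ] lower x h₂ h₃ * upper (x +ᵛ h₁) h₂ h₃
      ≡⟨ ∑-cong A (λ x → trans (∑-comm D D _) (∑-cong D λ h₂ → ∑-comm D D _)) ⟩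
    ∑[ x ∈ A ] ∑[ h₂ ∈ D ] ∑[ h₃ ∈ D ] ∑[ h₁ ∈ D ] lower x h₂ h₃ * upper (x +ᵛ h₁) h₂ h₃
      ≡⟨ trans (∑-comm A D _) (∑-cong D λ h₂ → ∑-comm A D _) ⟩
    ∑[ h₂ ∈ D ] ∑[ h₃ ∈ D ] ∑[ x ∈ A ] ∑[ h₁ ∈ D ] lower x h₂ h₃ * upper (x +ᵛ h₁) h₂ h₃
      ≡⟨ ∑-cong D (λ h₂ → ∑-cong D λ h₃ → ∑-cong-∈ A λ {x} x∈A →
           trans (∑-*ˡ D (lower x h₂ h₃) (λ h₁ → upper (x +ᵛ h₁) h₂ h₃))
             (cong (lower x h₂ h₃ *_) (∑-translate x∈A (λ y → upper y h₂ h₃)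
               (∏square-supported (upperFace f) h₂ h₃ supp)))) ⟩
    ∑[ h₂ ∈ D ] ∑[ h₃ ∈ D ] ∑[ x ∈ A ] lower x h₂ h₃ * face (upperFace f) h₂ h₃
      ≡⟨ ∑-cong D (λ h₂ → ∑-cong D λ h₃ → ∑-*ʳ A _ _) ⟩
    ∑[ h₂ ∈ D ] ∑[ h₃ ∈ D ] face (lowerFace f) h₂ h₃ * face (upperFace f) h₂ h₃ ∎
    where
    open ≡-Reasoning
    lower upper : ℤ^ d → ℤ^ d → ℤ^ d → ℕ
    lower y h₂ h₃ = ∏square (λ ω → lowerFace f ω (squareVertex y h₂ h₃ ω))
    upper y h₂ h₃ = ∏square (λ ω → upperFace f ω (squareVertex y h₂ h₃ ω))

  gowers-cauchy-schwarz : ∀ f → (∀ ω → Supported (f ω)) →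
                          ⟪ f ⟫ ² ≤ ⟪ f ∘ lowerCopy ⟫ * ⟪ f ∘ upperCopy ⟫
  gowers-cauchy-schwarz f supp = subst₂ _≤_
    (cong _² (sym (⟪⟫≡∑face*face f (supp _))))
    (sym (cong₂ _*_ (⟪⟫≡∑face*face (f ∘ lowerCopy) (supp _)) (⟪⟫≡∑face*face (f ∘ upperCopy) (supp _))))
    (cauchy-schwarz₂ D D (face (lowerFace f)) (face (upperFace f)))

  U3⁸≡⟪𝟙⟫ : ∀ {X} → Unique X → (∀ {y} → y ∈ X → y ∈ A) → U3⁸ X ≡ ⟪ (λ _ → 𝟙 X) ⟫
  U3⁸≡⟪𝟙⟫ {X} uniqX X⊆A = begin
    U3⁸ X
      ≡⟨ ∑-cong-∈ X shifts→differences ⟩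
    ∑[ x ∈ X ] ∑[ h₁ ∈ D ] ∑[ h₂ ∈ D ] ∑[ h₃ ∈ D ] cube x h₁ h₂ h₃
      ≡⟨ ∑-restrict uniqX uniqA X⊆A _ ⟩
    ∑[ x ∈ A ] 𝟙 X x * (∑[ h₁ ∈ D ] ∑[ h₂ ∈ D ] ∑[ h₃ ∈ D ] cube x h₁ h₂ h₃)
      ≡⟨ ∑-cong A (λ x → ∑-absorb D (𝟙 X x) _ λ h₁ → ∑-absorb D (𝟙 X x) _ λ h₂ →
           ∑-absorb D (𝟙 X x) _ λ h₃ → absorbs (false , false , false) x h₁ h₂ h₃) ⟩
    ⟪ (λ _ → 𝟙 X) ⟫ ∎
    where
    open ≡-Reasoning
    cube : ℤ^ d → ℤ^ d → ℤ^ d → ℤ^ d → ℕ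
    cube x h₁ h₂ h₃ = ∏cube (λ ω → 𝟙 X (vertex x h₁ h₂ h₃ ω))
    -- The weights 𝟙 X (x + h) produced by reindexing are absorbed by the cube product's
    -- factors at the vertices 100, 010, 001 (and 𝟙 X x by the one at 000).
    absorbs : ∀ ω x h₁ h₂ h₃ → 𝟙 X (vertex x h₁ h₂ h₃ ω) * cube x h₁ h₂ h₃ ≡ cube x h₁ h₂ h₃
    absorbs ω x h₁ h₂ h₃ = ∏cube-absorb (λ ω → 𝟙 X (vertex x h₁ h₂ h₃ ω)) ω (𝟙-idem X _)
    shifts→differences : ∀ {x} → x ∈ X →
      ∑[ h₁ ∈ shifts X x ] ∑[ h₂ ∈ shifts X x ] ∑[ h₃ ∈ shifts X x ] cube x h₁ h₂ h₃ ≡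
      ∑[ h₁ ∈ D ] ∑[ h₂ ∈ D ] ∑[ h₃ ∈ D ] cube x h₁ h₂ h₃
    shifts→differences {x} x∈X = trans
      (∑-shifts uniqX uniqD X-x⊆D _ λ h₁ → ∑-absorb S (𝟙 X (x +ᵛ h₁)) _ λ h₂ →
         ∑-absorb S (𝟙 X (x +ᵛ h₁)) _ λ h₃ → absorbs (true , false , false) x h₁ h₂ h₃)
      (∑-cong D λ h₁ → trans
        (∑-shifts uniqX uniqD X-x⊆D _ λ h₂ → ∑-absorb S (𝟙 X (x +ᵛ h₂)) _ λ h₃ →
           absorbs (false , true , false) x h₁ h₂ h₃)
        (∑-cong D λ h₂ → ∑-shifts uniqX uniqD X-x⊆D _ λ h₃ → absorbs (false , false , true) x h₁ h₂ h₃))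
      where
      S : List (ℤ^ d)
      S = shifts X x
      X-x⊆D : ∀ {y} → y ∈ X → y -ᵛ x ∈ D
      X-x⊆D y∈X = A-A⊆D (X⊆A x∈X) (X⊆A y∈X)

-- Affine colourings of the cube

𝟎 𝟏 : ℤ/2
𝟎 = zero
𝟏 = suc zero

+₂-identityʳ : ∀ c → c +₂ 𝟎 ≡ c
+₂-identityʳ zero       = refl
+₂-identityʳ (suc zero) = refl

+₂-cancelˡ : ∀ a {b c} → a +₂ b ≡ a +₂ c → b ≡ c
+₂-cancelˡ zero       eq = eq
+₂-cancelˡ (suc zero) {zero}     {zero}     eq = refl
+₂-cancelˡ (suc zero) {suc zero} {suc zero} eq = refl
+₂-cancelˡ (suc zero) {zero}     {suc zero} ()
+₂-cancelˡ (suc zero) {suc zero} {zero}     ()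

+₂-rightComm : ∀ a b c → (a +₂ b) +₂ c ≡ (a +₂ c) +₂ b
+₂-rightComm zero       zero       c          = sym (+₂-identityʳ c)
+₂-rightComm zero       (suc zero) zero       = refl
+₂-rightComm zero       (suc zero) (suc zero) = refl
+₂-rightComm (suc zero) zero       zero       = refl
+₂-rightComm (suc zero) zero       (suc zero) = refl
+₂-rightComm (suc zero) (suc zero) zero       = refl
+₂-rightComm (suc zero) (suc zero) (suc zero) = refl

_·_ : Bool → ℤ/2 → ℤ/2
true  · c = c
false · c = 𝟎

Affine : Set
Affine = ℤ/2 × ℤ/2 × ℤ/2 × ℤ/2

affine : Affine → Cube → ℤ/2
affine (c₀ , c₁ , c₂ , c₃) (ω₁ , ω₂ , ω₃) = ((c₀ +₂ (ω₁ · c₁)) +₂ (ω₂ · c₂)) +₂ (ω₃ · c₃)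

affine-injective : ∀ {a b} → (∀ ω → affine a ω ≡ affine b ω) → a ≡ b
affine-injective {c₀ , c₁ , c₂ , c₃} {e₀ , e₁ , e₂ , e₃} agree =
  cong₂ _,_ c₀≡e₀ (cong₂ _,_ c₁≡e₁ (cong₂ _,_ c₂≡e₂ c₃≡e₃))
  where
  +𝟎+𝟎 : ∀ c → (c +₂ 𝟎) +₂ 𝟎 ≡ c
  +𝟎+𝟎 c = trans (+₂-identityʳ _) (+₂-identityʳ c)
  c₀≡e₀ : c₀ ≡ e₀
  c₀≡e₀ = subst₂ _≡_ (trans (+𝟎+𝟎 _) (+₂-identityʳ c₀)) (trans (+𝟎+𝟎 _) (+₂-identityʳ e₀))
                       (agree (false , false , false))
  cancel : ∀ {c e} → c₀ +₂ c ≡ e₀ +₂ e → c ≡ e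
  cancel eq = +₂-cancelˡ c₀ (trans eq (cong (_+₂ _) (sym c₀≡e₀)))
  c₁≡e₁ : c₁ ≡ e₁
  c₁≡e₁ = cancel (subst₂ _≡_ (+𝟎+𝟎 (c₀ +₂ c₁)) (+𝟎+𝟎 (e₀ +₂ e₁)) (agree (true , false , false)))
  c₂≡e₂ : c₂ ≡ e₂
  c₂≡e₂ = cancel (subst₂ _≡_ (trans (+₂-identityʳ _) (cong (_+₂ c₂) (+₂-identityʳ c₀)))
                             (trans (+₂-identityʳ _) (cong (_+₂ e₂) (+₂-identityʳ e₀)))
                             (agree (false , true , false)))
  c₃≡e₃ : c₃ ≡ e₃
  c₃≡e₃ = cancel (subst₂ _≡_ (cong (_+₂ c₃) (+𝟎+𝟎 c₀)) (cong (_+₂ e₃) (+𝟎+𝟎 e₀))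
                             (agree (false , false , true)))

·-zeroʳ : ∀ ω → ω · 𝟎 ≡ 𝟎
·-zeroʳ true  = refl
·-zeroʳ false = refl

affine-constant : ∀ c ω → affine (c , 𝟎 , 𝟎 , 𝟎) ω ≡ c
affine-constant c (ω₁ , ω₂ , ω₃) rewrite ·-zeroʳ ω₁ | ·-zeroʳ ω₂ | ·-zeroʳ ω₃ =
  trans (+₂-identityʳ _) (trans (+₂-identityʳ _) (+₂-identityʳ c))

affine-lowerCopy : ∀ c₀ c₁ c₂ c₃ ω → affine (c₀ , c₁ , c₂ , c₃) (lowerCopy ω) ≡ affine (c₀ , 𝟎 , c₂ , c₃) ω
affine-lowerCopy c₀ c₁ c₂ c₃ (ω₁ , ω₂ , ω₃) rewrite ·-zeroʳ ω₁ = refl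

affine-upperCopy : ∀ c₀ c₁ c₂ c₃ ω →
                   affine (c₀ , c₁ , c₂ , c₃) (upperCopy ω) ≡ affine (c₀ +₂ c₁ , 𝟎 , c₂ , c₃) ω
affine-upperCopy c₀ c₁ c₂ c₃ (ω₁ , ω₂ , ω₃) rewrite ·-zeroʳ ω₁ | +₂-identityʳ (c₀ +₂ c₁) = refl

affine-swap₁₂ : ∀ c₀ c₁ c₂ c₃ ω → affine (c₀ , c₁ , c₂ , c₃) (swap₁₂ ω) ≡ affine (c₀ , c₂ , c₁ , c₃) ω
affine-swap₁₂ c₀ c₁ c₂ c₃ (ω₁ , ω₂ , ω₃) = cong (_+₂ (ω₃ · c₃)) (+₂-rightComm c₀ (ω₂ · c₁) (ω₁ · c₂))

affine-swap₂₃ : ∀ c₀ c₁ c₂ c₃ ω → affine (c₀ , c₁ , c₂ , c₃) (swap₂₃ ω) ≡ affine (c₀ , c₁ , c₃ , c₂) ω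
affine-swap₂₃ c₀ c₁ c₂ c₃ (ω₁ , ω₂ , ω₃) = +₂-rightComm (c₀ +₂ (ω₁ · c₁)) (ω₃ · c₂) (ω₂ · c₃)

∑₂ : (ℤ/2 → ℕ) → ℕ
∑₂ g = g 𝟎 + g 𝟏

∑₂-zero : ∀ g → (∀ c → g c ≡ 0) → ∑₂ g ≡ 0
∑₂-zero g g≗0 = cong₂ _+_ (g≗0 𝟎) (g≗0 𝟏)

∑₂-single : ∀ g p → (∀ c → c ≢ p → g c ≡ 0) → ∑₂ g ≡ g p
∑₂-single g zero       vanish = trans (cong (g 𝟎 +_) (vanish 𝟏 λ ())) (+-identityʳ _)
∑₂-single g (suc zero) vanish = cong (_+ g 𝟏) (vanish 𝟎 λ ())

∑-affine : (Affine → ℕ) → ℕ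
∑-affine g = ∑₂ λ c₀ → ∑₂ λ c₁ → ∑₂ λ c₂ → ∑₂ λ c₃ → g (c₀ , c₁ , c₂ , c₃)

∑-affine-single : ∀ g p → (∀ a → g a ≢ 0 → a ≡ p) → ∑-affine g ≡ g p
∑-affine-single g (p₀ , p₁ , p₂ , p₃) support = begin
  ∑-affine g
    ≡⟨ ∑₂-single _ p₀ (λ c₀ c₀≢p₀ → ∑₂-zero _ λ c₁ → ∑₂-zero _ λ c₂ → ∑₂-zero _ λ c₃ →
         vanish (c₀ , c₁ , c₂ , c₃) (c₀≢p₀ ∘ cong proj₁)) ⟩
  (∑₂ λ c₁ → ∑₂ λ c₂ → ∑₂ λ c₃ → g (p₀ , c₁ , c₂ , c₃))
    ≡⟨ ∑₂-single _ p₁ (λ c₁ c₁≢p₁ → ∑₂-zero _ λ c₂ → ∑₂-zero _ λ c₃ →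
         vanish (p₀ , c₁ , c₂ , c₃) (c₁≢p₁ ∘ cong (proj₁ ∘ proj₂))) ⟩
  (∑₂ λ c₂ → ∑₂ λ c₃ → g (p₀ , p₁ , c₂ , c₃))
    ≡⟨ ∑₂-single _ p₂ (λ c₂ c₂≢p₂ → ∑₂-zero _ λ c₃ →
         vanish (p₀ , p₁ , c₂ , c₃) (c₂≢p₂ ∘ cong (proj₁ ∘ proj₂ ∘ proj₂))) ⟩
  (∑₂ λ c₃ → g (p₀ , p₁ , p₂ , c₃))
    ≡⟨ ∑₂-single _ p₃ (λ c₃ c₃≢p₃ → vanish (p₀ , p₁ , p₂ , c₃) (c₃≢p₃ ∘ cong (proj₂ ∘ proj₂ ∘ proj₂))) ⟩
  g (p₀ , p₁ , p₂ , p₃) ∎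
  where
  open ≡-Reasoning
  vanish : ∀ a → a ≢ (p₀ , p₁ , p₂ , p₃) → g a ≡ 0
  vanish a a≢p with g a ≟ 0
  ... | yes ga≡0 = ga≡0
  ... | no  ga≢0 = contradiction (support a ga≢0) a≢p

∑-∑₂ : ∀ (L : List V) (G : V → ℤ/2 → ℕ) {H : ℤ/2 → ℕ} →
       (∀ c → ∑[ x ∈ L ] G x c ≡ H c) → ∑[ x ∈ L ] ∑₂ (G x) ≡ ∑₂ H
∑-∑₂ L G eq = trans (∑-distrib-+ L (λ x → G x 𝟎) (λ x → G x 𝟏)) (cong₂ _+_ (eq 𝟎) (eq 𝟏))

∑-∑-affine : ∀ (L : List V) (g : V → Affine → ℕ) →
             ∑[ x ∈ L ] ∑-affine (g x) ≡ ∑-affine (λ a → ∑[ x ∈ L ] g x a)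
∑-∑-affine L g =
  ∑-∑₂ L (λ x c₀ → ∑₂ λ c₁ → ∑₂ λ c₂ → ∑₂ λ c₃ → g x (c₀ , c₁ , c₂ , c₃)) λ c₀ →
  ∑-∑₂ L (λ x c₁ → ∑₂ λ c₂ → ∑₂ λ c₃ → g x (c₀ , c₁ , c₂ , c₃)) λ c₁ →
  ∑-∑₂ L (λ x c₂ → ∑₂ λ c₃ → g x (c₀ , c₁ , c₂ , c₃)) λ c₂ →
  ∑-∑₂ L (λ x c₃ → g x (c₀ , c₁ , c₂ , c₃)) λ c₃ → refl

n²≤k*0⇒n≡0 : ∀ k n → n ² ≤ k * 0 → n ≡ 0
n²≤k*0⇒n≡0 k zero    _   = refl
n²≤k*0⇒n≡0 k (suc n) n²≤0 = contradiction (≤-trans n²≤0 (≤-reflexive (*-zeroʳ k))) λ ()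

-- The numerical inequality

module FibreArithmetic (a b S T M : ℕ) where

  private
    n N : ℕ
    n = a + b
    N = S + T + M

  -- Expand N n³ once through n³ = a³ + b³ + 3abn and once through N = S + T + M.
  3abN<Mn² : S * n ^ 3 < N * a ^ 3 → T * n ^ 3 < N * b ^ 3 → 3 * a * b * N < M * n ²
  3abN<Mn² Sn³<Na³ Tn³<Nb³ = *-cancelʳ-< n _ _ (+-cancelˡ-< (N * a ^ 3 + N * b ^ 3) _ _ (begin-strict
    N * a ^ 3 + N * b ^ 3 + 3 * a * b * N * n   ≡⟨ binomial a b S T M ⟩
    S * n ^ 3 + T * n ^ 3 + M * n ^ 3           <⟨ +-mono-<-≤ (+-mono-< Sn³<Na³ Tn³<Nb³) ≤-refl ⟩
    N * a ^ 3 + N * b ^ 3 + M * n ^ 3           ≡⟨ cong (N * a ^ 3 + N * b ^ 3 +_) (cube-split M n) ⟩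
    N * a ^ 3 + N * b ^ 3 + M * n ² * n         ∎))
    where
    open ≤-Reasoning
    binomial : ∀ a b S T M → (S + T + M) * (a * (a * (a * 1))) + (S + T + M) * (b * (b * (b * 1)))
                               + 3 * a * b * (S + T + M) * (a + b)
                           ≡ S * ((a + b) * ((a + b) * ((a + b) * 1))) + T * ((a + b) * ((a + b) * ((a + b) * 1)))
                               + M * ((a + b) * ((a + b) * ((a + b) * 1)))
    binomial = solve-∀
    cube-split : ∀ M n → M * (n * (n * (n * 1))) ≡ M * (n * n) * n
    cube-split = solve-∀

  9n²<196ab : M ² ≤ 196 * (S * T) → S * n ^ 3 < N * a ^ 3 → T * n ^ 3 < N * b ^ 3 → 9 * n ² < 196 * (a * b)
  9n²<196ab M²≤196ST Sn³<Na³ Tn³<Nb³ = *-cancelʳ-< ((a * b * N) ²) _ _ (begin-strict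
    9 * n ² * (a * b * N) ²           ≡⟨ e₁ a b n N ⟩
    (3 * a * b * N) ² * n ²           ≤⟨ *-monoˡ-≤ (n ²) (*-mono-≤ 3abN≤Mn² 3abN≤Mn²) ⟩
    (M * n ²) ² * n ²                 ≡⟨ e₂ M n ⟩
    M ² * (n ^ 3) ²                   ≤⟨ *-monoˡ-≤ ((n ^ 3) ²) M²≤196ST ⟩
    196 * (S * T) * (n ^ 3) ²         ≡⟨ e₃ S T n ⟩
    196 * ((S * n ^ 3) * (T * n ^ 3)) <⟨ *-monoʳ-< 196 (*-mono-< Sn³<Na³ Tn³<Nb³) ⟩
    196 * ((N * a ^ 3) * (N * b ^ 3)) ≡⟨ e₄ a b N ⟩
    196 * (a * b) * (a * b * N) ²     ∎)
    where
    open ≤-Reasoning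
    3abN≤Mn² : 3 * a * b * N ≤ M * n ²
    3abN≤Mn² = <⇒≤ (3abN<Mn² Sn³<Na³ Tn³<Nb³)
    e₁ : ∀ a b n N → 9 * (n * n) * ((a * b * N) * (a * b * N)) ≡ (3 * a * b * N) * (3 * a * b * N) * (n * n)
    e₁ = solve-∀
    e₂ : ∀ M n → (M * (n * n)) * (M * (n * n)) * (n * n) ≡ M * M * ((n * (n * (n * 1))) * (n * (n * (n * 1))))
    e₂ = solve-∀
    e₃ : ∀ S T n → 196 * (S * T) * ((n * (n * (n * 1))) * (n * (n * (n * 1))))
                 ≡ 196 * ((S * (n * (n * (n * 1)))) * (T * (n * (n * (n * 1)))))
    e₃ = solve-∀
    e₄ : ∀ a b N → 196 * ((N * (a * (a * (a * 1)))) * (N * (b * (b * (b * 1)))))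
                 ≡ 196 * (a * b) * ((a * b * N) * (a * b * N))
    e₄ = solve-∀

  fibre-inequality : M ² ≤ 196 * (S * T) → 100 * (a * b) ≤ n ² →
                     N * a ^ 3 ≤ S * n ^ 3 ⊎ N * b ^ 3 ≤ T * n ^ 3
  fibre-inequality M²≤196ST 100ab≤n² with N * a ^ 3 ≤? S * n ^ 3 | N * b ^ 3 ≤? T * n ^ 3
  ... | yes first | _          = inj₁ first
  ... | no  _     | yes second = inj₂ second
  ... | no ¬first | no ¬second = contradiction 900n²<196n² (≤⇒≯ (*-monoˡ-≤ (n ²) (m≤m+n 196 704)))
    where
    open ≤-Reasoning
    900n²<196n² : 900 * n ² < 196 * n ²
    900n²<196n² = begin-strict
      900 * n ²             ≡⟨ *-assoc 100 9 (n ²) ⟩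
      100 * (9 * n ²)       <⟨ *-monoʳ-< 100 (9n²<196ab M²≤196ST (≰⇒> ¬first) (≰⇒> ¬second)) ⟩
      100 * (196 * (a * b)) ≡⟨ x∙yz≈y∙xz 100 196 (a * b) ⟩
      196 * (100 * (a * b)) ≤⟨ *-monoʳ-≤ 196 100ab≤n² ⟩
      196 * n ²             ∎

100ab≤[a+b]² : ∀ a b → 100 * a ≤ a + b ⊎ 100 * b ≤ a + b → 100 * (a * b) ≤ (a + b) ²
100ab≤[a+b]² a b (inj₁ 100a≤n) = subst (_≤ (a + b) ²) (*-assoc 100 a b) (*-mono-≤ 100a≤n (m≤n+m b a))
100ab≤[a+b]² a b (inj₂ 100b≤n) = subst (_≤ (a + b) ²) (100-shuffle a b) (*-mono-≤ (m≤m+n a b) 100b≤n)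
  where
  100-shuffle : ∀ a b → a * (100 * b) ≡ 100 * (a * b)
  100-shuffle = solve-∀

some-fibre-inequality : ∀ a b S T M → 0 < a + b → M ² ≤ 196 * (S * T) →
  (a ≡ 0 → S ≡ 0) → (b ≡ 0 → T ≡ 0) → 100 * a ≤ a + b ⊎ 100 * b ≤ a + b →
  (0 < a × (S + T + M) * a ^ 3 ≤ S * (a + b) ^ 3) ⊎ (0 < b × (S + T + M) * b ^ 3 ≤ T * (a + b) ^ 3)
some-fibre-inequality zero b S T M n>0 M²≤196ST S≡0 _ _
  rewrite S≡0 refl | n²≤k*0⇒n≡0 196 M M²≤196ST = inj₂ (n>0 , ≤-reflexive (only-second T b))
  where
  only-second : ∀ T b → (0 + T + 0) * (b * (b * (b * 1))) ≡ T * ((0 + b) * ((0 + b) * ((0 + b) * 1)))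
  only-second = solve-∀
some-fibre-inequality (suc a) zero S T M _ M²≤196ST _ T≡0 _
  rewrite T≡0 refl | *-zeroʳ S | n²≤k*0⇒n≡0 196 M M²≤196ST =
  inj₁ (s≤s z≤n , ≤-reflexive (only-first S (suc a)))
  where
  only-first : ∀ S a → (S + 0 + 0) * (a * (a * (a * 1))) ≡ S * ((a + 0) * ((a + 0) * ((a + 0) * 1)))
  only-first = solve-∀
some-fibre-inequality (suc a) (suc b) S T M _ M²≤196ST _ _ small =
  Sum.map (s≤s z≤n ,_) (s≤s z≤n ,_) (FibreArithmetic.fibre-inequality (suc a) (suc b) S T M M²≤196ST
                                              (100ab≤[a+b]² (suc a) (suc b) small))

-- Splitting A along φ

module _ {d : ℕ} where

  length-fibres : ∀ (φ : ℤ^ d → ℤ/2) A → length (fibre φ A 𝟎) + length (fibre φ A 𝟏) ≡ length A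
  length-fibres φ []      = refl
  length-fibres φ (x ∷ A) with φ x
  ... | zero     = cong suc (length-fibres φ A)
  ... | suc zero = trans (+-suc _ _) (cong suc (length-fibres φ A))

  U3⁸-[] : ∀ {X : List (ℤ^ d)} → length X ≡ 0 → U3⁸ X ≡ 0
  U3⁸-[] {[]} _ = refl

  differences : List (ℤ^ d) → List (ℤ^ d)
  differences A = deduplicate _≟ᵛ_ (concatMap (shifts A) A)

  differences-unique : ∀ A → Unique (differences A)
  differences-unique A = Uniqueᵈ.deduplicate-! _≟ᵛ_ _

  ∈-differences : ∀ {A x y} → x ∈ A → y ∈ A → y -ᵛ x ∈ differences A
  ∈-differences {A} x∈A y∈A = Anyₚ.deduplicate⁺ _≟ᵛ_ (λ { refl e → e })
    (∈-concatMap⁺ (shifts A) (Any.map (λ { refl → ∈-map⁺ (_-ᵛ _) y∈A }) x∈A))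

module FibreDecomposition {d} {A : List (ℤ^ d)} (uniqA : Unique A) (φ : ℤ^ d → ℤ/2)
                          (φ-hom : ∀ x y → φ (x +ᵛ y) ≡ φ x +₂ φ y) where

  open GowersInnerProduct uniqA (differences-unique A) ∈-differences

  A[_] : ℤ/2 → List (ℤ^ d)
  A[ c ] = fibre φ A c

  fibre-unique : ∀ c → Unique A[ c ]
  fibre-unique c = Uniqueₚ.filter⁺ (λ x → φ x ≟₂ c) uniqA

  fibre⊆A : ∀ {c v} → v ∈ A[ c ] → v ∈ A
  fibre⊆A {c} v∈A[c] = proj₁ (∈-filter⁻ (λ x → φ x ≟₂ c) v∈A[c])

  𝟙-fibre : ∀ {c v} → φ v ≡ c → 𝟙 A[ c ] v ≡ 𝟙 A v
  𝟙-fibre {c} {v} φv≡c with any? (v ≟ᵛ_) A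
  ... | yes v∈A = 𝟙-∈ (∈-filter⁺ (λ x → φ x ≟₂ c) v∈A φv≡c)
  ... | no  v∉A = 𝟙-∉ (v∉A ∘ fibre⊆A)

  𝟙-fibre-≢0 : ∀ {c v} → 𝟙 A[ c ] v ≢ 0 → φ v ≡ c
  𝟙-fibre-≢0 {c} {v} ≢0 with any? (v ≟ᵛ_) A[ c ]
  ... | yes v∈A[c] = proj₂ (∈-filter⁻ (λ x → φ x ≟₂ c) {xs = A} v∈A[c])
  ... | no  _      = contradiction refl ≢0

  fibre-supported : ∀ c → Supported (𝟙 A[ c ])
  fibre-supported c v with any? (v ≟ᵛ_) A[ c ]
  ... | yes v∈A[c] = cong (_* 1) (𝟙-∈ (fibre⊆A v∈A[c]))
  ... | no  _      = *-zeroʳ (𝟙 A v)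

  φ-vertex : ∀ x h₁ h₂ h₃ ω → φ (vertex x h₁ h₂ h₃ ω) ≡ affine (φ x , φ h₁ , φ h₂ , φ h₃) ω
  φ-vertex x h₁ h₂ h₃ (ω₁ , ω₂ , ω₃) =
    trans (φ-scale ω₃ h₃ _) (cong (_+₂ (ω₃ · φ h₃))
      (trans (φ-scale ω₂ h₂ _) (cong (_+₂ (ω₂ · φ h₂)) (φ-scale ω₁ h₁ x))))
    where
    φ-scale : ∀ ω h v → φ (scale ω h v) ≡ φ v +₂ (ω · φ h)
    φ-scale true  h v = φ-hom v h
    φ-scale false h v = sym (+₂-identityʳ (φ v))

  G : Affine → ℕ
  G a = ⟪ (λ ω → 𝟙 A[ affine a ω ]) ⟫

  -- Only the colouring (φ x , φ h₁ , φ h₂ , φ h₃) contributes: 𝟙 A[ c ] v vanishes unless φ v = c,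
  -- and an affine colouring is determined by its values at the vertices 000, 100, 010, 001.
  ∏cube-𝟙-decomposition : ∀ x h₁ h₂ h₃ → ∏cube (λ ω → 𝟙 A (vertex x h₁ h₂ h₃ ω)) ≡
    ∑-affine (λ a → ∏cube (λ ω → 𝟙 A[ affine a ω ] (vertex x h₁ h₂ h₃ ω)))
  ∏cube-𝟙-decomposition x h₁ h₂ h₃ = sym (trans
    (∑-affine-single coloured (φ x , φ h₁ , φ h₂ , φ h₃) λ a ∏≢0 → affine-injective λ ω →
      trans (sym (𝟙-fibre-≢0 (∏≢0 ∘ ∏cube-zero (colouredAt a) ω))) (φ-vertex x h₁ h₂ h₃ ω))
    (∏cube-cong λ ω → 𝟙-fibre (φ-vertex x h₁ h₂ h₃ ω)))
    where
    colouredAt : Affine → Cube → ℕ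
    colouredAt a ω = 𝟙 A[ affine a ω ] (vertex x h₁ h₂ h₃ ω)
    coloured : Affine → ℕ
    coloured a = ∏cube (colouredAt a)

  U3⁸≡∑G : U3⁸ A ≡ ∑-affine G
  U3⁸≡∑G = begin
    U3⁸ A
      ≡⟨ U3⁸≡⟪𝟙⟫ uniqA (λ y∈A → y∈A) ⟩
    ⟪ (λ _ → 𝟙 A) ⟫
      ≡⟨ ∑-cong A (λ x → ∑-cong D λ h₁ → ∑-cong D λ h₂ → ∑-cong D λ h₃ → ∏cube-𝟙-decomposition x h₁ h₂ h₃) ⟩
    ∑[ x ∈ A ] ∑[ h₁ ∈ D ] ∑[ h₂ ∈ D ] ∑[ h₃ ∈ D ] ∑-affine (term x h₁ h₂ h₃)
      ≡⟨ ∑-cong A (λ x → ∑-cong D λ h₁ → ∑-cong D λ h₂ → ∑-∑-affine D (term x h₁ h₂)) ⟩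
    ∑[ x ∈ A ] ∑[ h₁ ∈ D ] ∑[ h₂ ∈ D ] ∑-affine (λ a → ∑[ h₃ ∈ D ] term x h₁ h₂ h₃ a)
      ≡⟨ ∑-cong A (λ x → ∑-cong D λ h₁ → ∑-∑-affine D λ h₂ a → ∑[ h₃ ∈ D ] term x h₁ h₂ h₃ a) ⟩
    ∑[ x ∈ A ] ∑[ h₁ ∈ D ] ∑-affine (λ a → ∑[ h₂ ∈ D ] ∑[ h₃ ∈ D ] term x h₁ h₂ h₃ a)
      ≡⟨ ∑-cong A (λ x → ∑-∑-affine D λ h₁ a → ∑[ h₂ ∈ D ] ∑[ h₃ ∈ D ] term x h₁ h₂ h₃ a) ⟩
    ∑[ x ∈ A ] ∑-affine (λ a → ∑[ h₁ ∈ D ] ∑[ h₂ ∈ D ] ∑[ h₃ ∈ D ] term x h₁ h₂ h₃ a)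
      ≡⟨ ∑-∑-affine A (λ x a → ∑[ h₁ ∈ D ] ∑[ h₂ ∈ D ] ∑[ h₃ ∈ D ] term x h₁ h₂ h₃ a) ⟩
    ∑-affine G ∎
    where
    open ≡-Reasoning
    D : List (ℤ^ d)
    D = differences A
    term : ℤ^ d → ℤ^ d → ℤ^ d → ℤ^ d → Affine → ℕ
    term x h₁ h₂ h₃ a = ∏cube (λ ω → 𝟙 A[ affine a ω ] (vertex x h₁ h₂ h₃ ω))

  ⟪𝟙⟫-recolour : ∀ (κ κ′ : Cube → ℤ/2) → (∀ ω → κ ω ≡ κ′ ω) →
                 ⟪ (λ ω → 𝟙 A[ κ ω ]) ⟫ ≡ ⟪ (λ ω → 𝟙 A[ κ′ ω ]) ⟫
  ⟪𝟙⟫-recolour κ κ′ κ≗κ′ = ⟪⟫-cong {λ ω → 𝟙 A[ κ ω ]} {λ ω → 𝟙 A[ κ′ ω ]}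
    λ ω v → cong (λ c → 𝟙 A[ c ] v) (κ≗κ′ ω)

  U3⁸-fibre : ∀ c → U3⁸ A[ c ] ≡ G (c , 𝟎 , 𝟎 , 𝟎)
  U3⁸-fibre c = trans (U3⁸≡⟪𝟙⟫ (fibre-unique c) fibre⊆A)
                      (⟪𝟙⟫-recolour (λ _ → c) _ (sym ∘ affine-constant c))

  G-cauchy-schwarz : ∀ c₀ c₁ c₂ c₃ →
                     G (c₀ , c₁ , c₂ , c₃) ² ≤ G (c₀ , 𝟎 , c₂ , c₃) * G (c₀ +₂ c₁ , 𝟎 , c₂ , c₃)
  G-cauchy-schwarz c₀ c₁ c₂ c₃ = subst (G (c₀ , c₁ , c₂ , c₃) ² ≤_)
    (cong₂ _*_ (⟪𝟙⟫-recolour (affine (c₀ , c₁ , c₂ , c₃) ∘ lowerCopy) (affine (c₀ , 𝟎 , c₂ , c₃))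
                             (affine-lowerCopy c₀ c₁ c₂ c₃))
               (⟪𝟙⟫-recolour (affine (c₀ , c₁ , c₂ , c₃) ∘ upperCopy) (affine (c₀ +₂ c₁ , 𝟎 , c₂ , c₃))
                             (affine-upperCopy c₀ c₁ c₂ c₃)))
    (gowers-cauchy-schwarz (λ ω → 𝟙 A[ affine (c₀ , c₁ , c₂ , c₃) ω ])
                           (fibre-supported ∘ affine (c₀ , c₁ , c₂ , c₃)))

  G-swap₁₂ : ∀ c₀ c₁ c₂ c₃ → G (c₀ , c₂ , c₁ , c₃) ≡ G (c₀ , c₁ , c₂ , c₃)
  G-swap₁₂ c₀ c₁ c₂ c₃ = trans
    (sym (⟪𝟙⟫-recolour (affine (c₀ , c₁ , c₂ , c₃) ∘ swap₁₂) _ (affine-swap₁₂ c₀ c₁ c₂ c₃)))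
    (⟪⟫-swap₁₂ (λ ω → 𝟙 A[ affine (c₀ , c₁ , c₂ , c₃) ω ]))

  G-swap₂₃ : ∀ c₀ c₁ c₂ c₃ → G (c₀ , c₁ , c₃ , c₂) ≡ G (c₀ , c₁ , c₂ , c₃)
  G-swap₂₃ c₀ c₁ c₂ c₃ = trans
    (sym (⟪𝟙⟫-recolour (affine (c₀ , c₁ , c₂ , c₃) ∘ swap₂₃) _ (affine-swap₂₃ c₀ c₁ c₂ c₃)))
    (⟪⟫-swap₂₃ (λ ω → 𝟙 A[ affine (c₀ , c₁ , c₂ , c₃) ω ]))

  S T : ℕ
  S = G (𝟎 , 𝟎 , 𝟎 , 𝟎)
  T = G (𝟏 , 𝟎 , 𝟎 , 𝟎)

  Bounded : ℕ → Set
  Bounded n = n ² ≤ S * T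

  -- Cauchy–Schwarz in the first direction lowers the slope; the swaps move any remaining
  -- slope into the first direction.
  bounded-by-cauchy-schwarz : ∀ c₀ c₂ c₃ → Bounded (G (c₀ , 𝟎 , c₂ , c₃)) →
                              Bounded (G (c₀ +₂ 𝟏 , 𝟎 , c₂ , c₃)) → Bounded (G (c₀ , 𝟏 , c₂ , c₃))
  bounded-by-cauchy-schwarz c₀ c₂ c₃ = ²≤-via-geometric-mean
    (G (c₀ , 𝟏 , c₂ , c₃)) (G (c₀ , 𝟎 , c₂ , c₃)) (G (c₀ +₂ 𝟏 , 𝟎 , c₂ , c₃)) (G-cauchy-schwarz c₀ 𝟏 c₂ c₃)

  G[c,1,0,0]-bounded : ∀ c → Bounded (G (c , 𝟏 , 𝟎 , 𝟎))
  G[c,1,0,0]-bounded zero       = G-cauchy-schwarz 𝟎 𝟏 𝟎 𝟎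
  G[c,1,0,0]-bounded (suc zero) = subst (G (𝟏 , 𝟏 , 𝟎 , 𝟎) ² ≤_) (*-comm T S) (G-cauchy-schwarz 𝟏 𝟏 𝟎 𝟎)

  G[c,0,1,0]-bounded : ∀ c → Bounded (G (c , 𝟎 , 𝟏 , 𝟎))
  G[c,0,1,0]-bounded c = subst Bounded (G-swap₁₂ c 𝟎 𝟏 𝟎) (G[c,1,0,0]-bounded c)

  G[c,0,0,1]-bounded : ∀ c → Bounded (G (c , 𝟎 , 𝟎 , 𝟏))
  G[c,0,0,1]-bounded c = subst Bounded (G-swap₂₃ c 𝟎 𝟎 𝟏) (G[c,0,1,0]-bounded c)

  G[c,1,1,0]-bounded : ∀ c → Bounded (G (c , 𝟏 , 𝟏 , 𝟎))
  G[c,1,1,0]-bounded c = bounded-by-cauchy-schwarz c 𝟏 𝟎 (G[c,0,1,0]-bounded c) (G[c,0,1,0]-bounded (c +₂ 𝟏))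

  G[c,1,0,1]-bounded : ∀ c → Bounded (G (c , 𝟏 , 𝟎 , 𝟏))
  G[c,1,0,1]-bounded c = bounded-by-cauchy-schwarz c 𝟎 𝟏 (G[c,0,0,1]-bounded c) (G[c,0,0,1]-bounded (c +₂ 𝟏))

  G[c,0,1,1]-bounded : ∀ c → Bounded (G (c , 𝟎 , 𝟏 , 𝟏))
  G[c,0,1,1]-bounded c = subst Bounded (G-swap₁₂ c 𝟎 𝟏 𝟏) (G[c,1,0,1]-bounded c)

  G[c,1,1,1]-bounded : ∀ c → Bounded (G (c , 𝟏 , 𝟏 , 𝟏))
  G[c,1,1,1]-bounded c = bounded-by-cauchy-schwarz c 𝟏 𝟏 (G[c,0,1,1]-bounded c) (G[c,0,1,1]-bounded (c +₂ 𝟏))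

  slopeTerms : ℤ/2 → List ℕ
  slopeTerms c = G (c , 𝟎 , 𝟎 , 𝟏) ∷ G (c , 𝟎 , 𝟏 , 𝟎) ∷ G (c , 𝟎 , 𝟏 , 𝟏) ∷ G (c , 𝟏 , 𝟎 , 𝟎) ∷
                 G (c , 𝟏 , 𝟎 , 𝟏) ∷ G (c , 𝟏 , 𝟏 , 𝟎) ∷ G (c , 𝟏 , 𝟏 , 𝟏) ∷ []

  slopeTerms-bounded : ∀ c → All Bounded (slopeTerms c)
  slopeTerms-bounded c =
    G[c,0,0,1]-bounded c ∷ G[c,0,1,0]-bounded c ∷ G[c,0,1,1]-bounded c ∷ G[c,1,0,0]-bounded c ∷
    G[c,1,0,1]-bounded c ∷ G[c,1,1,0]-bounded c ∷ G[c,1,1,1]-bounded c ∷ []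

  crossTerms : List ℕ
  crossTerms = slopeTerms 𝟎 ++ slopeTerms 𝟏

  crossTerms-bounded : All Bounded crossTerms
  crossTerms-bounded = Allₚ.++⁺ (slopeTerms-bounded 𝟎) (slopeTerms-bounded 𝟏)

  M : ℕ
  M = ∑[ n ∈ crossTerms ] n

  M²≤196ST : M ² ≤ 196 * (S * T)
  M²≤196ST = begin
    M ²                                ≤⟨ ∑²≤length*∑² crossTerms (λ n → n) ⟩
    14 * (∑[ n ∈ crossTerms ] n ²)     ≤⟨ *-monoʳ-≤ 14 (∑-mono-≤-∈ crossTerms (All.lookup crossTerms-bounded)) ⟩
    14 * (∑[ _ ∈ crossTerms ] S * T)   ≡⟨ cong (14 *_) (∑-const crossTerms (S * T)) ⟩
    14 * (14 * (S * T))                ≡⟨ *-assoc 14 14 (S * T) ⟨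
    196 * (S * T)                      ∎
    where open ≤-Reasoning

  ∑G≡S+T+M : ∑-affine G ≡ S + T + M
  ∑G≡S+T+M = regroup
    (G (𝟎 , 𝟎 , 𝟎 , 𝟎)) (G (𝟎 , 𝟎 , 𝟎 , 𝟏)) (G (𝟎 , 𝟎 , 𝟏 , 𝟎)) (G (𝟎 , 𝟎 , 𝟏 , 𝟏))
    (G (𝟎 , 𝟏 , 𝟎 , 𝟎)) (G (𝟎 , 𝟏 , 𝟎 , 𝟏)) (G (𝟎 , 𝟏 , 𝟏 , 𝟎)) (G (𝟎 , 𝟏 , 𝟏 , 𝟏))
    (G (𝟏 , 𝟎 , 𝟎 , 𝟎)) (G (𝟏 , 𝟎 , 𝟎 , 𝟏)) (G (𝟏 , 𝟎 , 𝟏 , 𝟎)) (G (𝟏 , 𝟎 , 𝟏 , 𝟏))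
    (G (𝟏 , 𝟏 , 𝟎 , 𝟎)) (G (𝟏 , 𝟏 , 𝟎 , 𝟏)) (G (𝟏 , 𝟏 , 𝟏 , 𝟎)) (G (𝟏 , 𝟏 , 𝟏 , 𝟏))
    where
    regroup : ∀ a₀ a₁ a₂ a₃ a₄ a₅ a₆ a₇ b₀ b₁ b₂ b₃ b₄ b₅ b₆ b₇ →
      ((a₀ + a₁) + (a₂ + a₃)) + ((a₄ + a₅) + (a₆ + a₇)) + (((b₀ + b₁) + (b₂ + b₃)) + ((b₄ + b₅) + (b₆ + b₇)))
      ≡ a₀ + b₀ + (a₁ + (a₂ + (a₃ + (a₄ + (a₅ + (a₆ + (a₇ + (b₁ + (b₂ + (b₃ + (b₄ + (b₅ + (b₆ + (b₇ + 0))))))))))))))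
    regroup = solve-∀

lemma3p7 : (d : ℕ) → 1 ≤ d →
    (A : List (ℤ^ d)) → Unique A → 0 < length A →
    (φ : ℤ^ d → ℤ/2) →
    (∀ x y → φ (x +ᵛ y) ≡ φ x +₂ φ y) →
    (∀ i → ∃ λ x → φ x ≡ i) →
    (∃ λ i → 100 * length (fibre φ A i) ≤ length A) →
    ∃ λ i → 0 < length (fibre φ A i) ×
      U3⁸ A * length (fibre φ A i) ^ 3 ≤ U3⁸ (fibre φ A i) * length A ^ 3
lemma3p7 _ _ A uniqA |A|>0 φ φ-hom _ (i , small) =
  Sum.[ (λ (a>0 , ineq) → 𝟎 , a>0 , rescale 𝟎 ineq) , (λ (b>0 , ineq) → 𝟏 , b>0 , rescale 𝟏 ineq) ]′
    (some-fibre-inequality a b S T M (subst (0 <_) (sym a+b≡|A|) |A|>0) M²≤196ST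
      (λ a≡0 → trans (sym (U3⁸-fibre 𝟎)) (U3⁸-[] {X = A[ 𝟎 ]} a≡0))
      (λ b≡0 → trans (sym (U3⁸-fibre 𝟏)) (U3⁸-[] {X = A[ 𝟏 ]} b≡0))
      (small-fibre i small))
  where
  open FibreDecomposition uniqA φ φ-hom
  a b : ℕ
  a = length A[ 𝟎 ]
  b = length A[ 𝟏 ]
  a+b≡|A| : a + b ≡ length A
  a+b≡|A| = length-fibres φ A
  small-fibre : ∀ i → 100 * length A[ i ] ≤ length A → 100 * a ≤ a + b ⊎ 100 * b ≤ a + b
  small-fibre zero       small = inj₁ (subst (100 * a ≤_) (sym a+b≡|A|) small)
  small-fibre (suc zero) small = inj₂ (subst (100 * b ≤_) (sym a+b≡|A|) small)
  rescale : ∀ c → (S + T + M) * length A[ c ] ^ 3 ≤ G (c , 𝟎 , 𝟎 , 𝟎) * (a + b) ^ 3 →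
            U3⁸ A * length A[ c ] ^ 3 ≤ U3⁸ A[ c ] * length A ^ 3
  rescale c = subst₂ (λ N R → N * length A[ c ] ^ 3 ≤ R)
    (sym (trans U3⁸≡∑G ∑G≡S+T+M)) (cong₂ (λ K n → K * n ^ 3) (sym (U3⁸-fibre c)) a+b≡|A|)
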